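{- Let $k \geq 3$ and let $T = S(d_1,\dots,d_k)$ be a spider that is not a caterpillar. Let $S \subseteq V(T)$ be the set of all internal (non-leaf) vertices of $T$. Then $S$ is a multicover of $T$.
   Context: For a graph $G$, $d(u,v)$ is the distance, $\mathrm{ecc}(v)$ the eccentricity of $v$, and $N_r[v] = \{u : d(u,v) \le r\}$. A multicover of $G$ is a set $S \subseteq V(G)$ such that $|N_r[v]\cap S| \ge r$ for every $v \in V(G)$ and every $1 \le r \le \mathrm{ecc}(v)$. A spider $S(d_1,\dots,d_k)$ ($k \ge 3$) has a branch vertex $u$ of degree $k$ and $k$ leaves, the $i$-th joined to $u$ by a path of length $d_i \ge 1$, all other vertices having degree $2$. A caterpillar is a tree in which deleting all leaves leaves a path; a spider is a caterpillar iff at most two of the $d_i$ exceed $1$. -}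

module Defs where

open import Level using (0ℓ)
open import Data.Nat using (ℕ; zero; suc; _≤_; _<_; _∸_)
open import Data.Fin using (Fin)
open import Data.Product using (Σ; ∃; _×_; _,_)
open import Relation.Nullary using (¬_)
open import Relation.Binary.PropositionalEquality using (_≡_; _≢_)
open import Function.Definitions using (Injective)

record Graph : Set₁ where
  field
    V   : Set
    Adj : V → V → Set

module _ (G : Graph) where
  open Graph G

  data Walk : ℕ → V → V → Set where
    nil  : ∀ {v} → Walk 0 v v
    cons : ∀ {n u w v} → Adj u w → Walk n w v → Walk (suc n) u v

  Within : ℕ → V → V → Set
  Within r u v = ∃ λ ℓ → ℓ ≤ r × Walk ℓ u v

  Dist : V → V → ℕ → Set
  Dist u v d = Within d u v × (∀ d′ → d′ < d → ¬ Within d′ u v)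

  Ecc : V → ℕ → Set
  Ecc v e = (∃ λ u → Dist v u e) × (∀ u d → Dist v u d → d ≤ e)

  Ball : ℕ → V → V → Set
  Ball r v u = Within r u v

  IsLeaf : V → Set
  IsLeaf v = ∃ λ w → Adj v w × (∀ w′ → Adj v w′ → w′ ≡ w)

  AtLeast : ℕ → (V → Set) → Set
  AtLeast r P = Σ (Fin r → V) λ f → Injective _≡_ _≡_ f × (∀ i → P (f i))

  Multicover : (V → Set) → Set
  Multicover S = ∀ v e → Ecc v e → ∀ r → 1 ≤ r → r ≤ e →
                 AtLeast r (λ u → Ball r v u × S u)

-- The spider S(d_1,…,d_k): centre `ctr`, and on leg i the vertices at
-- distance 1,…,d i from the centre; `leg i j _` is at distance j+1.

module _ {k : ℕ} (d : Fin k → ℕ) where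

  data SpV : Set where
    ctr : SpV
    leg : (i : Fin k) (j : ℕ) → j < d i → SpV

  data SpAdj : SpV → SpV → Set where
    c-l : ∀ i (p : 0 < d i) → SpAdj ctr (leg i 0 p)
    l-c : ∀ i (p : 0 < d i) → SpAdj (leg i 0 p) ctr
    l-l : ∀ i j (p : j < d i) (q : suc j < d i) → SpAdj (leg i j p) (leg i (suc j) q)
    l-l′ : ∀ i j (p : j < d i) (q : suc j < d i) → SpAdj (leg i (suc j) q) (leg i j p)

  Spider : Graph
  Spider = record { V = SpV ; Adj = SpAdj }

  -- a spider is a caterpillar iff at most two d_i exceed 1; so it is not a
  -- caterpillar iff three distinct legs have length ≥ 2
  NotCaterpillar : Set
  NotCaterpillar = ∃ λ i₁ → ∃ λ i₂ → ∃ λ i₃ →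
    i₁ ≢ i₂ × i₁ ≢ i₃ × i₂ ≢ i₃ × 2 ≤ d i₁ × 2 ≤ d i₂ × 2 ≤ d i₃

  Internal : SpV → Set
  Internal v = ¬ IsLeaf Spider v

-- Every vertex strictly inside a path is internal, and so is the centre. For r ≤ ecc(v) = d(v,u)
-- one therefore finds r internal vertices within distance r of v near the path from v to u: on
-- v's leg, inside v (when r ≤ d(v, centre)) or outside v (when u lies farther out on that leg),
-- or, when the path crosses the centre, v's leg up to v, the centre and the first vertices of
-- u's leg. If in this last case v is itself a leaf, it is replaced by the neighbour of the centre
-- on a third leg of length at least 2, which exists because the spider is not a caterpillar.
module Submission where

open import Defs
open import Data.Nat using (ℕ; zero; suc; _+_; _∸_; _≤_; _<_; z≤n; s≤s; s≤s⁻¹; _≤?_; _<?_)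
open import Data.Nat.Properties
open import Data.Fin using (Fin; toℕ; splitAt; join; inject≤) renaming (zero to fzero; _≟_ to _≟ᶠ_)
open import Data.Fin.Properties using (toℕ-injective; toℕ<n; join-splitAt; inject≤-injective)
open import Data.Product using (∃; _×_; _,_; proj₁; proj₂)
open import Data.Sum using (inj₁; inj₂; [_,_]′)
open import Data.Empty using (⊥-elim)
open import Function using (_∘_)
open import Function.Definitions using (Injective)
open import Relation.Nullary using (Dec; yes; no; contradiction)
open import Relation.Unary using (Pred; _∩_; _∪_; _⊥′_; ｛_｝)
open import Relation.Binary using (Symmetric)
open import Relation.Binary.PropositionalEquality

⊥′-∪ : ∀ {a ℓ₁ ℓ₂ ℓ₃} {A : Set a} {P : Pred A ℓ₁} {Q : Pred A ℓ₂} {R : Pred A ℓ₃} →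
       P ⊥′ Q → P ⊥′ R → P ⊥′ (Q ∪ R)
⊥′-∪ P⊥Q P⊥R x (x∈P , inj₁ x∈Q) = P⊥Q x (x∈P , x∈Q)
⊥′-∪ P⊥Q P⊥R x (x∈P , inj₂ x∈R) = P⊥R x (x∈P , x∈R)

m<n⇒∃[o]m+suc[o]≡n : ∀ {m n} → m < n → ∃ λ o → m + suc o ≡ n
m<n⇒∃[o]m+suc[o]≡n {m} m<n with o , 1+m+o≡n ← m≤n⇒∃[o]m+o≡n m<n = o , trans (+-suc m o) 1+m+o≡n

module _ (G : Graph) where
  open Graph G

  Walk-++ : ∀ {m n u w v} → Walk G m u w → Walk G n w v → Walk G (m + n) u v
  Walk-++ nil         q = q
  Walk-++ (cons a p) q = cons a (Walk-++ p q)

  Walk-reverse : Symmetric Adj → ∀ {n u v} → Walk G n u v → Walk G n v u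
  Walk-reverse sym-adj nil = nil
  Walk-reverse sym-adj {suc n} {u} {v} (cons a w) =
    subst (λ ℓ → Walk G ℓ v u) (+-comm n 1) (Walk-++ (Walk-reverse sym-adj w) (cons (sym-adj a) nil))

  Within-refl : ∀ {u} → Within G 0 u u
  Within-refl = 0 , z≤n , nil

  Within-adj : ∀ {u v} → Adj u v → Within G 1 u v
  Within-adj a = 1 , ≤-refl , cons a nil

  Within-mono : ∀ {m n u v} → m ≤ n → Within G m u v → Within G n u v
  Within-mono m≤n (ℓ , ℓ≤m , w) = ℓ , ≤-trans ℓ≤m m≤n , w

  Within-trans : ∀ {m n u w v} → Within G m u w → Within G n w v → Within G (m + n) u v
  Within-trans (ℓ , ℓ≤m , p) (ℓ′ , ℓ′≤n , q) = ℓ + ℓ′ , +-mono-≤ ℓ≤m ℓ′≤n , Walk-++ p q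

  Within-sym : Symmetric Adj → ∀ {n} → Symmetric (Within G n)
  Within-sym sym-adj (ℓ , ℓ≤n , w) = ℓ , ℓ≤n , Walk-reverse sym-adj w

  DistAtLeast : ℕ → V → V → Set
  DistAtLeast r u v = ∀ ℓ → Within G ℓ u v → r ≤ ℓ

  Dist⇒DistAtLeast : ∀ {u v e r} → Dist G u v e → r ≤ e → DistAtLeast r u v
  Dist⇒DistAtLeast (_ , minimal) r≤e ℓ within = ≤-trans r≤e (≮⇒≥ λ ℓ<e → minimal ℓ ℓ<e within)

module _ (G : Graph) (P : Graph.V G → Set) where
  open Graph G

  AtLeast-∩ˡ : ∀ {r} (Q : V → Set) → AtLeast G r (P ∩ Q) → AtLeast G r P
  AtLeast-∩ˡ _ (f , f-inj , f∈P∩Q) = f , f-inj , proj₁ ∘ f∈P∩Q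

  AtLeast-≤ : ∀ {m n} → m ≤ n → AtLeast G n P → AtLeast G m P
  AtLeast-≤ m≤n (f , f-inj , f∈P) =
    (λ i → f (inject≤ i m≤n)) , inject≤-injective m≤n m≤n _ _ ∘ f-inj , λ i → f∈P (inject≤ i m≤n)

  AtLeast-｛｝ : ∀ {x} → P x → AtLeast G 1 (P ∩ ｛ x ｝)
  AtLeast-｛｝ {x} x∈P = (λ _ → x) , (λ { {fzero} {fzero} _ → refl }) , λ _ → x∈P , refl

  AtLeast-∪ : ∀ {m n} {A B : V → Set} → A ⊥′ B →
              AtLeast G m (P ∩ A) → AtLeast G n (P ∩ B) → AtLeast G (m + n) (P ∩ (A ∪ B))
  AtLeast-∪ {m} {n} {A} {B} A⊥B (f , f-inj , f∈) (g , g-inj , g∈) =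
    [ f , g ]′ ∘ splitAt m , splitAt-injective ∘ [f,g]-injective , membership ∘ splitAt m
    where
    [f,g]-injective : Injective _≡_ _≡_ [ f , g ]′
    [f,g]-injective {inj₁ i} {inj₁ j} eq = cong inj₁ (f-inj eq)
    [f,g]-injective {inj₁ i} {inj₂ j} eq = ⊥-elim (A⊥B _ (proj₂ (f∈ i) , subst B (sym eq) (proj₂ (g∈ j))))
    [f,g]-injective {inj₂ i} {inj₁ j} eq = ⊥-elim (A⊥B _ (proj₂ (f∈ j) , subst B eq (proj₂ (g∈ i))))
    [f,g]-injective {inj₂ i} {inj₂ j} eq = cong inj₂ (g-inj eq)
    splitAt-injective : Injective _≡_ _≡_ (splitAt m {n})
    splitAt-injective {i} {j} eq =
      trans (sym (join-splitAt m n i)) (trans (cong (join m n) eq) (join-splitAt m n j))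
    membership : ∀ s → (P ∩ (A ∪ B)) ([ f , g ]′ s)
    membership (inj₁ i) = proj₁ (f∈ i) , inj₁ (proj₂ (f∈ i))
    membership (inj₂ j) = proj₁ (g∈ j) , inj₂ (proj₂ (g∈ j))

  AtLeast-⊎ : ∀ {m n} {A B : V → Set} → A ⊥′ B →
              AtLeast G m (P ∩ A) → AtLeast G n (P ∩ B) → AtLeast G (m + n) P
  AtLeast-⊎ {A = A} {B} A⊥B P∩A P∩B = AtLeast-∩ˡ (A ∪ B) (AtLeast-∪ A⊥B P∩A P∩B)

module _ {k : ℕ} (d : Fin k → ℕ) where
  private
    Sp : Graph
    Sp = Spider d

  SpAdj-sym : Symmetric (SpAdj d)
  SpAdj-sym (c-l i p)      = l-c i p
  SpAdj-sym (l-c i p)      = c-l i p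
  SpAdj-sym (l-l i j p q)  = l-l′ i j p q
  SpAdj-sym (l-l′ i j p q) = l-l i j p q

  Spider-within-sym : ∀ {n} → Symmetric (Within Sp n)
  Spider-within-sym = Within-sym Sp SpAdj-sym

  leg-index-injective : ∀ {i i′ j j′} {p : j < d i} {p′ : j′ < d i′} →
                        leg i j p ≡ leg i′ j′ p′ → j ≡ j′
  leg-index-injective refl = refl

  leg-within-ctr : ∀ i j (p : j < d i) → Within Sp (suc j) (leg i j p) ctr
  leg-within-ctr i zero    p = Within-adj Sp (l-c i p)
  leg-within-ctr i (suc j) p =
    Within-trans Sp (Within-adj Sp (l-l′ i j (<⇒≤ p) p)) (leg-within-ctr i j (<⇒≤ p))

  leg-descends : ∀ i m {j j′} (p : j < d i) (p′ : j′ < d i) → m + j ≡ j′ →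
                 Within Sp m (leg i j′ p′) (leg i j p)
  leg-descends i zero    p p′ refl =
    subst (Within Sp 0 _) (cong (leg i _) (<-irrelevant p′ p)) (Within-refl Sp)
  leg-descends i (suc m) p p′ refl =
    Within-trans Sp (Within-adj Sp (l-l′ i _ (<⇒≤ p′) p′)) (leg-descends i m p (<⇒≤ p′) refl)

  leg-within-leg : ∀ {i j j′ n} (p : j < d i) (p′ : j′ < d i) → j ≤ j′ + n → j′ ≤ j + n →
                   Within Sp n (leg i j p) (leg i j′ p′)
  leg-within-leg {i} {j} {j′} p p′ j≤j′+n j′≤j+n with ≤-total j j′
  ... | inj₁ j≤j′ = Within-mono Sp (m≤n+o⇒m∸n≤o j′ j j′≤j+n)
                      (Spider-within-sym (leg-descends i (j′ ∸ j) p p′ (m∸n+n≡m j≤j′)))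
  ... | inj₂ j′≤j = Within-mono Sp (m≤n+o⇒m∸n≤o j j′ j≤j′+n)
                      (leg-descends i (j ∸ j′) p′ p (m∸n+n≡m j′≤j))

  inner-leg-within : ∀ {i j j′ n} (p : j < d i) (p′ : j′ < d i) → j ≤ j′ → j′ ≤ n →
                     Within Sp n (leg i j p) (leg i j′ p′)
  inner-leg-within {j = j} {j′} {n} p p′ j≤j′ j′≤n =
    leg-within-leg p p′ (≤-trans j≤j′ (m≤m+n j′ n)) (≤-trans j′≤n (m≤n+m n j))

  legs-within : ∀ {a b j j′} (p : j < d a) (p′ : j′ < d b) →
                Within Sp (suc j + suc j′) (leg a j p) (leg b j′ p′)
  legs-within p p′ = Within-trans Sp (leg-within-ctr _ _ p) (Spider-within-sym (leg-within-ctr _ _ p′))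

  leg-internal : ∀ i j (p : j < d i) → suc j < d i → Internal d (leg i j p)
  leg-internal i zero    p q (_ , _ , only) with only _ (l-c i p) | only _ (l-l i 0 p q)
  ... | refl | ()
  leg-internal i (suc j) p q (_ , _ , only) with only _ (l-l′ i j (<⇒≤ p) p) | only _ (l-l i (suc j) p q)
  ... | refl | ()

  ctr-internal : ∀ {a b} → a ≢ b → 0 < d a → 0 < d b → Internal d ctr
  ctr-internal a≢b pa pb (_ , _ , only) with only _ (c-l _ pa) | only _ (c-l _ pb)
  ... | refl | refl = a≢b refl

  LongLegAvoiding : Fin k → Fin k → Set
  LongLegAvoiding a b = ∃ λ c → c ≢ a × c ≢ b × 2 ≤ d c

  NotCaterpillar⇒LongLegAvoiding : NotCaterpillar d → ∀ a b → LongLegAvoiding a b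
  NotCaterpillar⇒LongLegAvoiding (i₁ , i₂ , i₃ , i₁≢i₂ , i₁≢i₃ , i₂≢i₃ , l₁ , l₂ , l₃) a b
    with i₁ ≟ᶠ a | i₁ ≟ᶠ b | i₂ ≟ᶠ a | i₂ ≟ᶠ b
  ... | no i₁≢a  | no i₁≢b  | _        | _        = i₁ , i₁≢a , i₁≢b , l₁
  ... | _        | _        | no i₂≢a  | no i₂≢b  = i₂ , i₂≢a , i₂≢b , l₂
  ... | yes refl | _        | yes refl | _        = ⊥-elim (i₁≢i₂ refl)
  ... | _        | yes refl | _        | yes refl = ⊥-elim (i₁≢i₂ refl)
  ... | yes refl | _        | _        | yes refl = i₃ , i₁≢i₃ ∘ sym , i₂≢i₃ ∘ sym , l₃
  ... | _        | yes refl | yes refl | _        = i₃ , i₂≢i₃ ∘ sym , i₁≢i₃ ∘ sym , l₃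

  NotCaterpillar⇒ctr-internal : NotCaterpillar d → Internal d ctr
  NotCaterpillar⇒ctr-internal (_ , _ , _ , i₁≢i₂ , _ , _ , l₁ , l₂ , _) =
    ctr-internal i₁≢i₂ (≤-trans (s≤s z≤n) l₁) (≤-trans (s≤s z≤n) l₂)

  data OnLeg (i : Fin k) : SpV d → Set where
    on-leg : ∀ j p → OnLeg i (leg i j p)

  OnLeg-⊥′ : ∀ {a b} → a ≢ b → OnLeg a ⊥′ OnLeg b
  OnLeg-⊥′ a≢b _ (on-leg _ _ , on-leg _ _) = a≢b refl

  ctr-⊥′-OnLeg : ∀ {i} → ｛ ctr ｝ ⊥′ OnLeg i
  ctr-⊥′-OnLeg _ (refl , ())

  OnLeg-⊥′-ctr : ∀ {i} → OnLeg i ⊥′ ｛ ctr ｝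
  OnLeg-⊥′-ctr _ (() , refl)

  Near : ℕ → SpV d → SpV d → Set
  Near r v = Ball Sp r v ∩ Internal d

  near-segment : ∀ {r v} i lo n → lo + n < d i →
                 (∀ j (p : j < d i) → lo ≤ j → j < lo + n → Within Sp r (leg i j p) v) →
                 AtLeast Sp n (Near r v ∩ OnLeg i)
  near-segment {r} {v} i lo n bound close = vertex , vertex-injective , membership
    where
    in-range : (m : Fin n) → lo + toℕ m < lo + n
    in-range m = +-monoʳ-< lo (toℕ<n m)
    vertex : Fin n → SpV d
    vertex m = leg i (lo + toℕ m) (<-trans (in-range m) bound)
    vertex-injective : Injective _≡_ _≡_ vertex
    vertex-injective = toℕ-injective ∘ +-cancelˡ-≡ lo _ _ ∘ leg-index-injective
    membership : ∀ m → (Near r v ∩ OnLeg i) (vertex m)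
    membership m = (close _ _ (m≤m+n lo _) (in-range m) , leg-internal i _ _ (≤-<-trans (in-range m) bound))
                 , on-leg _ _

  module _ (ctr-int : Internal d ctr) (long-leg : ∀ a b → LongLegAvoiding a b) where

    near-ctr-segment : ∀ {r v} b t → t < d b → Within Sp r ctr v →
                       (∀ j (p : j < d b) → j < t → Within Sp r (leg b j p) v) →
                       AtLeast Sp (suc t) (Near r v ∩ (｛ ctr ｝ ∪ OnLeg b))
    near-ctr-segment {r} {v} b t t<d ctr-close close =
      AtLeast-∪ Sp (Near r v) ctr-⊥′-OnLeg (AtLeast-｛｝ Sp (Near r v) (ctr-close , ctr-int))
        (near-segment b 0 t t<d λ j p _ → close j p)

    near-ctr : ∀ b r → r < d b → AtLeast Sp (suc r) (Near (suc r) ctr)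
    near-ctr b r r<d = AtLeast-∩ˡ Sp (Near (suc r) ctr) (｛ ctr ｝ ∪ OnLeg b)
      (near-ctr-segment b r r<d (Within-mono Sp z≤n (Within-refl Sp))
        λ j p j<r → Within-mono Sp (s≤s (<⇒≤ j<r)) (leg-within-ctr b j p))

    near-inward : ∀ a x (p : x < d a) r → r ≤ suc x → AtLeast Sp r (Near r (leg a x p))
    near-inward a x p r r≤sx with r ≤? x
    ... | yes r≤x with x ∸ r | m∸n+n≡m r≤x
    ...   | lo | refl = AtLeast-∩ˡ Sp (Near r (leg a x p)) (OnLeg a)
      (near-segment a lo r p λ j q lo≤j j<x →
        leg-within-leg q p (≤-trans (<⇒≤ j<x) (m≤m+n _ r)) (+-monoˡ-≤ r lo≤j))
    near-inward a x p r r≤sx | no r≰x =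
      AtLeast-≤ Sp (Near r (leg a x p)) r≤sx (AtLeast-∩ˡ Sp (Near r (leg a x p)) (｛ ctr ｝ ∪ OnLeg a)
        (near-ctr-segment a x p (Within-mono Sp (≰⇒> r≰x) (Spider-within-sym (leg-within-ctr a x p)))
          λ j q j<x → inner-leg-within q p (<⇒≤ j<x) (<⇒≤ (≰⇒> r≰x))))

    near-outward : ∀ a x (p : x < d a) r → x + r < d a → AtLeast Sp r (Near r (leg a x p))
    near-outward a x p r x+r<d = AtLeast-∩ˡ Sp (Near r (leg a x p)) (OnLeg a)
      (near-segment a x r x+r<d λ j q x≤j j<x+r →
        leg-within-leg q p (<⇒≤ j<x+r) (≤-trans x≤j (m≤m+n j r)))

    near-through : ∀ {a b} → a ≢ b → ∀ x (p : x < d a) t → t < d b →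
                   AtLeast Sp (suc x + suc t) (Near (suc x + suc t) (leg a x p))
    near-through {a} {b} a≢b x p t t<d = by-end-of-leg (suc x <? d a)
      where
      R : ℕ
      R = suc x + suc t
      v : SpV d
      v = leg a x p
      x≤R : x ≤ R
      x≤R = ≤-trans (n≤1+n x) (m≤m+n (suc x) (suc t))
      own-leg : ∀ n → n ≤ suc x → n < d a → AtLeast Sp n (Near R v ∩ OnLeg a)
      own-leg n n≤sx n<d = near-segment a 0 n n<d λ j q _ j<n →
        inner-leg-within q p (s≤s⁻¹ (≤-trans j<n n≤sx)) x≤R
      via-ctr : ∀ {c} j (q : j < d c) → j ≤ t → Within Sp R (leg c j q) v
      via-ctr j q j≤t = Within-mono Sp (+-monoʳ-≤ (suc x) (s≤s j≤t)) (Spider-within-sym (legs-within p q))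
      ctr-and-leg-b : AtLeast Sp (suc t) (Near R v ∩ (｛ ctr ｝ ∪ OnLeg b))
      ctr-and-leg-b = near-ctr-segment b t t<d
        (Within-mono Sp (m≤m+n (suc x) (suc t)) (Spider-within-sym (leg-within-ctr a x p)))
        λ j q j<t → via-ctr j q (<⇒≤ j<t)
      a⊥ctr-and-b : OnLeg a ⊥′ (｛ ctr ｝ ∪ OnLeg b)
      a⊥ctr-and-b = ⊥′-∪ OnLeg-⊥′-ctr (OnLeg-⊥′ a≢b)
      by-end-of-leg : Dec (suc x < d a) → AtLeast Sp R (Near R v)
      by-end-of-leg (yes sx<d) =
        AtLeast-⊎ Sp (Near R v) a⊥ctr-and-b (own-leg (suc x) ≤-refl sx<d) ctr-and-leg-b
      by-end-of-leg (no _) with long-leg a b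
      ... | c , c≢a , c≢b , 2≤dc =
        AtLeast-⊎ Sp (Near R v) (⊥′-∪ (OnLeg-⊥′ c≢a) (⊥′-∪ OnLeg-⊥′-ctr (OnLeg-⊥′ c≢b)))
          (near-segment c 0 1 2≤dc λ j q _ j<1 → via-ctr j q (≤-trans (s≤s⁻¹ j<1) z≤n))
          (AtLeast-∪ Sp (Near R v) a⊥ctr-and-b (own-leg x (n≤1+n x) p) ctr-and-leg-b)

    DistAtLeast⇒AtLeast-Near : ∀ v u r → 1 ≤ r → DistAtLeast Sp r v u → AtLeast Sp r (Near r v)
    DistAtLeast⇒AtLeast-Near ctr ctr r 1≤r far = contradiction (≤-trans 1≤r (far 0 (Within-refl Sp))) λ ()
    DistAtLeast⇒AtLeast-Near ctr (leg b y q) zero () far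
    DistAtLeast⇒AtLeast-Near ctr (leg b y q) (suc r) _ far =
      near-ctr b r (≤-<-trans (s≤s⁻¹ (far _ (Spider-within-sym (leg-within-ctr b y q)))) q)
    DistAtLeast⇒AtLeast-Near (leg a x p) ctr r _ far = near-inward a x p r (far _ (leg-within-ctr a x p))
    DistAtLeast⇒AtLeast-Near (leg a x p) (leg b y q) r _ far with b ≟ᶠ a | x <? y
    ... | yes refl | yes x<y = near-outward a x p r (≤-<-trans x+r≤y q)
      where
      x+r≤y : x + r ≤ y
      x+r≤y = ≤-trans (+-monoʳ-≤ x (far _ x⇝y)) (≤-reflexive (m+[n∸m]≡n (<⇒≤ x<y)))
        where
        x⇝y : Within Sp (y ∸ x) (leg a x p) (leg a y q)
        x⇝y = leg-within-leg p q (≤-trans (<⇒≤ x<y) (m≤m+n y _)) (m≤n+m∸n y x)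
    ... | yes refl | no x≮y = near-inward a x p r
      (≤-trans (far x (Spider-within-sym (inner-leg-within q p (≮⇒≥ x≮y) ≤-refl))) (n≤1+n x))
    ... | no b≢a | _ with r ≤? suc x
    ...   | yes r≤sx = near-inward a x p r r≤sx
    ...   | no r≰sx with t , refl ← m<n⇒∃[o]m+suc[o]≡n (≰⇒> r≰sx) =
      near-through (b≢a ∘ sym) x p t (≤-<-trans t≤y q)
      where
      t≤y : t ≤ y
      t≤y = s≤s⁻¹ (+-cancelˡ-≤ (suc x) _ _ (far _ (legs-within p q)))

mainTheorem10 : (k : ℕ) → 3 ≤ k → (d : Fin k → ℕ) → (∀ i → 1 ≤ d i) →
    NotCaterpillar d → Multicover (Spider d) (Internal d)
mainTheorem10 _ _ d _ not-caterpillar v e ((u , v-u-dist) , _) r 1≤r r≤e =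
  DistAtLeast⇒AtLeast-Near d (NotCaterpillar⇒ctr-internal d not-caterpillar)
    (NotCaterpillar⇒LongLegAvoiding d not-caterpillar) v u r 1≤r (Dist⇒DistAtLeast (Spider d) v-u-dist r≤e)
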